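{- Let $\mathcal{M}=\mathbb{Q}^{<\omega}$ and let $R(\bar x,\bar y)$ be definable in $\langle\mathcal{M},+\rangle$. Then there is a natural number $K$ such that for every tuple $\bar a$ in $\mathcal{M}$ the following are equivalent: (1) $R(\bar a,\bar b)$ holds for some (equivalently, for every) linearly independent tuple $\bar b$ with $\mathcal{V}(\bar a)\cap\mathcal{V}(\bar b)=\{\vec 0\}$; (2) $(\exists_{>K}\bar y)R(\bar a,\bar y)$.
   Context: $\mathcal{M}=\mathbb{Q}^{<\omega}$ is the $\mathbb{Q}$-vector space of finitely supported rational sequences, with zero $\vec 0$; $\mathcal{V}(\bar a)$ denotes the linear span of the entries of $\bar a$. "Definable" means first-order definable without parameters. $(\exists_{>k}y)Q(y)$ means there are at least $k+1$ pairwise distinct $y$ with $Q(y)$; for tuples, $(\exists_{>k}y_1,\dots,y_m)Q\equiv(\exists_{>k}y_1)(\exists_{>k}y_2,\dots,y_m)Q$. -}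

module Defs where

open import Data.Nat using (ℕ; zero; suc; _+_)
open import Data.Fin using (Fin)
open import Data.Vec using (Vec; []; _∷_; lookup; _++_)
open import Data.List using (List; []; _∷_)
open import Data.Rational using (ℚ; 0ℚ) renaming (_+_ to _+ℚ_; _*_ to _*ℚ_)
open import Data.Product using (Σ; _×_; _,_)
open import Data.Sum using (_⊎_)
open import Data.Empty using (⊥)
open import Relation.Nullary using (¬_)
open import Relation.Binary.PropositionalEquality using (_≡_; _≢_)

-- The carrier M = ℚ^{<ω}: finitely supported rational sequences.
-- An element is represented by a finite list of rationals (its initial
-- segment; all later coordinates are 0).  Two representations denote
-- the same element iff all their coordinates agree (setoid equality _≈_).

M : Set
M = List ℚ

coeff : M → ℕ → ℚ
coeff []       _       = 0ℚ
coeff (q ∷ _)  zero    = q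
coeff (_ ∷ xs) (suc i) = coeff xs i

infix 4 _≈_
_≈_ : M → M → Set
x ≈ y = ∀ i → coeff x i ≡ coeff y i

𝟎 : M
𝟎 = []

infixl 6 _⊕_
_⊕_ : M → M → M
[]       ⊕ ys       = ys
(x ∷ xs) ⊕ []       = x ∷ xs
(x ∷ xs) ⊕ (y ∷ ys) = (x +ℚ y) ∷ (xs ⊕ ys)

infixl 7 _⊙_
_⊙_ : ℚ → M → M
c ⊙ []       = []
c ⊙ (x ∷ xs) = (c *ℚ x) ∷ (c ⊙ xs)

lincomb : ∀ {k} → Vec ℚ k → Vec M k → M
lincomb []       []       = 𝟎
lincomb (c ∷ cs) (v ∷ vs) = (c ⊙ v) ⊕ lincomb cs vs

LinIndep : ∀ {k} → Vec M k → Set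
LinIndep {k} b = (c : Vec ℚ k) → lincomb c b ≈ 𝟎 → ∀ i → lookup c i ≡ 0ℚ

TrivialIntersection : ∀ {n m} → Vec M n → Vec M m → Set
TrivialIntersection {n} {m} a b =
  (c : Vec ℚ n) (d : Vec ℚ m) → lincomb c a ≈ lincomb d b → lincomb c a ≈ 𝟎

data Term (n : ℕ) : Set where
  var  : Fin n → Term n
  _+ₜ_ : Term n → Term n → Term n

data Formula : ℕ → Set where
  _≐_  : ∀ {n} → Term n → Term n → Formula n
  ¬'_  : ∀ {n} → Formula n → Formula n
  _∧'_ : ∀ {n} → Formula n → Formula n → Formula n
  _∨'_ : ∀ {n} → Formula n → Formula n → Formula n
  _⇒'_ : ∀ {n} → Formula n → Formula n → Formula n
  ∃'   : ∀ {n} → Formula (suc n) → Formula n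
  ∀'   : ∀ {n} → Formula (suc n) → Formula n

evalT : ∀ {n} → Term n → Vec M n → M
evalT (var i)  ρ = lookup ρ i
evalT (s +ₜ t) ρ = evalT s ρ ⊕ evalT t ρ

-- Tarskian satisfaction in ⟨M,+⟩; variable 0 is the most recently bound.
Sat : ∀ {n} → Formula n → Vec M n → Set
Sat (s ≐ t)  ρ = evalT s ρ ≈ evalT t ρ
Sat (¬' φ)   ρ = ¬ Sat φ ρ
Sat (φ ∧' ψ) ρ = Sat φ ρ × Sat ψ ρ
Sat (φ ∨' ψ) ρ = Sat φ ρ ⊎ Sat ψ ρ
Sat (φ ⇒' ψ) ρ = Sat φ ρ → Sat ψ ρ
Sat (∃' φ)   ρ = Σ M λ x → Sat φ (x ∷ ρ)
Sat (∀' φ)   ρ = (x : M) → Sat φ (x ∷ ρ)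

ExistsMoreThan : ℕ → (M → Set) → Set
ExistsMoreThan k P =
  Σ (Fin (suc k) → M) λ f →
    ((i j : Fin (suc k)) → i ≢ j → ¬ (f i ≈ f j)) × ((i : Fin (suc k)) → P (f i))

ExistsMoreThanTuple : ℕ → (m : ℕ) → (Vec M m → Set) → Set
ExistsMoreThanTuple k zero    Q = Q []
ExistsMoreThanTuple k (suc m) Q =
  ExistsMoreThan k λ y → ExistsMoreThanTuple k m λ ys → Q (y ∷ ys)

Rel : ∀ {n m} → Formula (n + m) → Vec M n → Vec M m → Set
Rel φ a b = Sat φ (a ++ b)

-- Quantifier elimination for ⟨ℚ^{<ω}, +⟩, in explicit form: whether a formula holds at an
-- assignment ρ depends only on which of finitely many rational linear forms vanish at ρ.
-- For ∃x the forms are combined pairwise to eliminate x; a witness x is then either a root of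
-- one of them, to be replaced by the corresponding root over the other assignment, or a root
-- of none, and then so is a unit vector beyond the supports of the other variables.
--
-- Call y generic over a when the forms vanishing at (a, y) do not involve y: all generic y
-- give the same pattern, hence R(a, y) for all of them or for none. Independent tuples with
-- 𝒱(a) ∩ 𝒱(y) = 0 are generic, and so are tuples of fresh unit vectors, of which there are
-- as many as needed. Conversely each of the K forms excludes at most one value of each
-- coordinate, so K + 1 distinct candidates per coordinate always contain a generic witness.

module Submission where

open import Defs
open import Data.Nat.Base as ℕ using (ℕ; zero; suc; _≤_; _<_; s≤s)
import Data.Nat.Properties as ℕₚ
open import Data.Fin.Base as Fin using (Fin; toℕ)
import Data.Fin.Properties as Finₚ
open import Data.Vec.Base as Vec using (Vec; []; _∷_; lookup; _++_)
import Data.Vec.Properties as Vecₚ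
open import Data.List.Base as List using (List; []; _∷_; length)
import Data.List.Properties as Listₚ
open import Data.List.Relation.Unary.Any as Any using (Any; here)
import Data.List.Relation.Unary.Any.Properties as Anyₚ
open import Data.List.Membership.Propositional using (_∈_; find; lose)
open import Data.List.Membership.Propositional.Properties
  using (∈-map⁺; ∈-++⁺ˡ; ∈-++⁺ʳ; ∈-cartesianProductWith⁺)
open import Data.Product.Base using (Σ; ∃; _×_; _,_; proj₁; proj₂)
open import Data.Sum.Base using (inj₁; inj₂)
open import Data.Empty using (⊥-elim)
open import Function.Base using (_∘_)
open import Function.Bundles using (_⇔_; mk⇔; module Equivalence)
open import Function.Construct.Symmetry using (⇔-sym)
open import Function.Construct.Composition using (_⇔-∘_)
open import Relation.Nullary using (¬_; Dec; yes; no; ¬?; _×-dec_)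
open import Relation.Nullary.Decidable using (map′)
open import Relation.Binary.PropositionalEquality

module _ {A B : Set} (_∼_ : A → A → Set) (P : B → A → Set) (P? : ∀ β x → Dec (P β x))
         (P-unique : ∀ β {x y} → P β x → P β y → x ∼ y) where

  pigeonhole-avoid : ∀ {K} (f : Fin (suc K) → A) → (∀ i j → i ≢ j → ¬ f i ∼ f j) →
                     (C : List B) → length C ≤ K → ∃ λ i → ¬ Any (λ β → P β (f i)) C
  pigeonhole-avoid {K} f distinct C |C|≤K with Finₚ.all? (λ i → Any.any? (λ β → P? β (f i)) C)
  ... | no notAll = Finₚ.¬∀⟶∃¬ (suc K) _ (λ i → Any.any? (λ β → P? β (f i)) C) notAll
  ... | yes met with Finₚ.pigeonhole (s≤s |C|≤K) (λ i → Any.index (met i))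
  ...   | i , j , i<j , sameIndex = ⊥-elim (distinct i j (Finₚ.<⇒≢ i<j)
            (P-unique _ (Anyₚ.lookup-index (met i))
              (subst (λ k → P (List.lookup C k) (f j)) (sym sameIndex) (Anyₚ.lookup-index (met j)))))

-- ℚ is opened only inside this module, so that _+_ in corollary1 is addition on ℕ.
module _ where
  open import Data.Rational.Base using (ℚ; 0ℚ; 1ℚ; _+_; _*_; -_; 1/_; ≢-nonZero)
  open import Data.Rational.Properties as ℚₚ using (_≟_)
  open import Data.Rational.Solver using (module +-*-Solver)
  open +-*-Solver
  open import Algebra.Properties.Group ℚₚ.+-0-group
    using (x∙y⁻¹≈ε⇒x≈y; x≈y⇒x∙y⁻¹≈ε; inverseʳ-unique)

  module _ {c : ℚ} (c≢0 : c ≢ 0ℚ) where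
    private instance
      c-nonZero = ≢-nonZero c≢0

    *-cancelˡ-≡ : ∀ x y → c * x ≡ c * y → x ≡ y
    *-cancelˡ-≡ x y cx≡cy = begin
      x                ≡⟨ sym (1/c*[c*x]≡x x) ⟩
      1/ c * (c * x)   ≡⟨ cong (1/ c *_) cx≡cy ⟩
      1/ c * (c * y)   ≡⟨ 1/c*[c*x]≡x y ⟩
      y                ∎
      where
      open ≡-Reasoning
      1/c*[c*x]≡x : ∀ x → 1/ c * (c * x) ≡ x
      1/c*[c*x]≡x x = begin
        1/ c * (c * x) ≡⟨ sym (ℚₚ.*-assoc (1/ c) c x) ⟩
        1/ c * c * x   ≡⟨ cong (_* x) (ℚₚ.*-inverseˡ c) ⟩
        1ℚ * x         ≡⟨ ℚₚ.*-identityˡ x ⟩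
        x              ∎

    ≡0⇔*≡0 : ∀ v → v ≡ 0ℚ ⇔ c * v ≡ 0ℚ
    ≡0⇔*≡0 v = mk⇔ (λ v≡0 → trans (cong (c *_) v≡0) (ℚₚ.*-zeroʳ c))
                   (λ cv≡0 → *-cancelˡ-≡ v 0ℚ (trans cv≡0 (sym (ℚₚ.*-zeroʳ c))))

    rootScale : ℚ
    rootScale = - (1/ c)

    rootScale-solves : ∀ d → c * (rootScale * d) + d ≡ 0ℚ
    rootScale-solves d = begin
      c * (- (1/ c) * d) + d ≡⟨ solve 3 (λ c c⁻¹ d → c :* (:- c⁻¹ :* d) :+ d := :- (c :* c⁻¹ :* d) :+ d)
                                        refl c (1/ c) d ⟩
      - (c * 1/ c * d) + d   ≡⟨ cong (λ u → - (u * d) + d) (ℚₚ.*-inverseʳ c) ⟩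
      - (1ℚ * d) + d         ≡⟨ solve 1 (λ d → :- (con 1ℚ :* d) :+ d := con 0ℚ) refl d ⟩
      0ℚ                     ∎
      where open ≡-Reasoning

  coeff-⊕ : ∀ x y i → coeff (x ⊕ y) i ≡ coeff x i + coeff y i
  coeff-⊕ []       y        i       = sym (ℚₚ.+-identityˡ _)
  coeff-⊕ (p ∷ xs) []       i       = sym (ℚₚ.+-identityʳ _)
  coeff-⊕ (p ∷ xs) (q ∷ ys) zero    = refl
  coeff-⊕ (p ∷ xs) (q ∷ ys) (suc i) = coeff-⊕ xs ys i

  coeff-⊙ : ∀ c x i → coeff (c ⊙ x) i ≡ c * coeff x i
  coeff-⊙ c []       i       = sym (ℚₚ.*-zeroʳ c)
  coeff-⊙ c (p ∷ xs) zero    = refl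
  coeff-⊙ c (p ∷ xs) (suc i) = coeff-⊙ c xs i

  tail : M → M
  tail []       = []
  tail (_ ∷ xs) = xs

  coeff-suc : ∀ x i → coeff x (suc i) ≡ coeff (tail x) i
  coeff-suc []       i = refl
  coeff-suc (_ ∷ xs) i = refl

  ≈-step : ∀ x y → Dec (tail x ≈ tail y) → Dec (x ≈ y)
  ≈-step x y tail? = map′ join split ((coeff x 0 ≟ coeff y 0) ×-dec tail?)
    where
    join : coeff x 0 ≡ coeff y 0 × tail x ≈ tail y → x ≈ y
    join (head≡ , tail≈) zero    = head≡
    join (head≡ , tail≈) (suc i) = trans (coeff-suc x i) (trans (tail≈ i) (sym (coeff-suc y i)))
    split : x ≈ y → coeff x 0 ≡ coeff y 0 × tail x ≈ tail y
    split x≈y = x≈y 0 , λ i → trans (sym (coeff-suc x i)) (trans (x≈y (suc i)) (coeff-suc y i))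

  infix 4 _≈?_
  _≈?_ : ∀ x y → Dec (x ≈ y)
  []       ≈? []       = yes λ _ → refl
  []       ≈? (q ∷ ys) = ≈-step [] (q ∷ ys) ([] ≈? ys)
  (p ∷ xs) ≈? []       = ≈-step (p ∷ xs) [] (xs ≈? [])
  (p ∷ xs) ≈? (q ∷ ys) = ≈-step (p ∷ xs) (q ∷ ys) (xs ≈? ys)

  coeff-length : ∀ x i → length x ≤ i → coeff x i ≡ 0ℚ
  coeff-length []       i       _         = refl
  coeff-length (_ ∷ xs) (suc i) (s≤s len≤i) = coeff-length xs i len≤i

  unit : ℕ → M
  unit zero    = 1ℚ ∷ []
  unit (suc p) = 0ℚ ∷ unit p

  coeff-unit-≡ : ∀ p → coeff (unit p) p ≡ 1ℚ
  coeff-unit-≡ zero    = refl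
  coeff-unit-≡ (suc p) = coeff-unit-≡ p

  coeff-unit-≢ : ∀ {p q} → p ≢ q → coeff (unit p) q ≡ 0ℚ
  coeff-unit-≢ {zero}  {zero}  p≢q = ⊥-elim (p≢q refl)
  coeff-unit-≢ {zero}  {suc q} p≢q = refl
  coeff-unit-≢ {suc p} {zero}  p≢q = refl
  coeff-unit-≢ {suc p} {suc q} p≢q = coeff-unit-≢ (λ p≡q → p≢q (cong suc p≡q))

  unit-injective : ∀ p q → unit p ≈ unit q → p ≡ q
  unit-injective p q unitp≈unitq with p ℕₚ.≟ q
  ... | yes p≡q = p≡q
  ... | no  p≢q = ⊥-elim (ℚₚ.1≢0 (begin
    1ℚ               ≡⟨ sym (coeff-unit-≡ p) ⟩
    coeff (unit p) p ≡⟨ unitp≈unitq p ⟩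
    coeff (unit q) p ≡⟨ coeff-unit-≢ (λ q≡p → p≢q (sym q≡p)) ⟩
    0ℚ               ∎))
    where open ≡-Reasoning

  dot : ∀ {n} → Vec ℚ n → Vec ℚ n → ℚ
  dot []      []      = 0ℚ
  dot (c ∷ l) (x ∷ w) = c * x + dot l w

  column : ∀ {n} → Vec M n → ℕ → Vec ℚ n
  column ρ i = Vec.map (λ v → coeff v i) ρ

  coeff-lincomb : ∀ {n} (l : Vec ℚ n) ρ i → coeff (lincomb l ρ) i ≡ dot l (column ρ i)
  coeff-lincomb []      []      i = refl
  coeff-lincomb (c ∷ l) (v ∷ ρ) i = trans (coeff-⊕ (c ⊙ v) (lincomb l ρ) i)
    (cong₂ _+_ (coeff-⊙ c v i) (coeff-lincomb l ρ i))

  addV : ∀ {n} → Vec ℚ n → Vec ℚ n → Vec ℚ n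
  addV = Vec.zipWith _+_

  scaleV : ∀ {n} → ℚ → Vec ℚ n → Vec ℚ n
  scaleV k = Vec.map (k *_)

  negV : ∀ {n} → Vec ℚ n → Vec ℚ n
  negV = Vec.map -_

  dot-addV : ∀ {n} (u v w : Vec ℚ n) → dot (addV u v) w ≡ dot u w + dot v w
  dot-addV []      []      []      = sym (ℚₚ.+-identityˡ 0ℚ)
  dot-addV (a ∷ u) (b ∷ v) (x ∷ w) = trans (cong ((a + b) * x +_) (dot-addV u v w))
    (solve 5 (λ a b x p q → (a :+ b) :* x :+ (p :+ q) := (a :* x :+ p) :+ (b :* x :+ q))
             refl a b x (dot u w) (dot v w))

  dot-scaleV : ∀ {n} k (u w : Vec ℚ n) → dot (scaleV k u) w ≡ k * dot u w
  dot-scaleV k []      []      = sym (ℚₚ.*-zeroʳ k)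
  dot-scaleV k (a ∷ u) (x ∷ w) = trans (cong (k * a * x +_) (dot-scaleV k u w))
    (solve 4 (λ k a x p → k :* a :* x :+ k :* p := k :* (a :* x :+ p)) refl k a x (dot u w))

  dot-negV : ∀ {n} (u w : Vec ℚ n) → dot (negV u) w ≡ - dot u w
  dot-negV []      []      = refl
  dot-negV (a ∷ u) (x ∷ w) = trans (cong (- a * x +_) (dot-negV u w))
    (solve 3 (λ a x p → :- a :* x :+ :- p := :- (a :* x :+ p)) refl a x (dot u w))

  dot-++ : ∀ {n m} (u : Vec ℚ n) (v : Vec ℚ m) w z → dot (u ++ v) (w ++ z) ≡ dot u w + dot v z
  dot-++ []      v []      z = sym (ℚₚ.+-identityˡ _)
  dot-++ (a ∷ u) v (x ∷ w) z =
    trans (cong (a * x +_) (dot-++ u v w z)) (sym (ℚₚ.+-assoc (a * x) (dot u w) (dot v z)))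

  dot-zeroʳ : ∀ {n} (l : Vec ℚ n) → dot l (Vec.replicate n 0ℚ) ≡ 0ℚ
  dot-zeroʳ []      = refl
  dot-zeroʳ (c ∷ l) =
    trans (cong (c * 0ℚ +_) (dot-zeroʳ l)) (solve 1 (λ c → c :* con 0ℚ :+ con 0ℚ := con 0ℚ) refl c)

  AllZero : ∀ {n} → Vec ℚ n → Set
  AllZero l = ∀ j → lookup l j ≡ 0ℚ

  allZero? : ∀ {n} (l : Vec ℚ n) → Dec (AllZero l)
  allZero? l = Finₚ.all? λ j → lookup l j ≟ 0ℚ

  dot-allZero : ∀ {n} (l w : Vec ℚ n) → AllZero l → dot l w ≡ 0ℚ
  dot-allZero []      []      _       = refl
  dot-allZero (c ∷ l) (x ∷ w) l≡0 = begin
    c * x + dot l w ≡⟨ cong₂ (λ a b → a * x + b) (l≡0 Fin.zero) (dot-allZero l w (l≡0 ∘ Fin.suc)) ⟩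
    0ℚ * x + 0ℚ     ≡⟨ solve 1 (λ x → con 0ℚ :* x :+ con 0ℚ := con 0ℚ) refl x ⟩
    0ℚ              ∎
    where open ≡-Reasoning

  bound : ∀ {n} → Vec M n → ℕ
  bound []      = 0
  bound (v ∷ ρ) = length v ℕ.⊔ bound ρ

  column-bound : ∀ {n} (ρ : Vec M n) i → bound ρ ≤ i → column ρ i ≡ Vec.replicate n 0ℚ
  column-bound []      i _ = refl
  column-bound (v ∷ ρ) i bound≤i = cong₂ _∷_
    (coeff-length v i (ℕₚ.≤-trans (ℕₚ.m≤m⊔n (length v) (bound ρ)) bound≤i))
    (column-bound ρ i (ℕₚ.≤-trans (ℕₚ.m≤n⊔m (length v) (bound ρ)) bound≤i))

  unitV : ∀ {n} → Fin n → Vec ℚ n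
  unitV {suc n} Fin.zero    = 1ℚ ∷ Vec.replicate n 0ℚ
  unitV {suc n} (Fin.suc j) = 0ℚ ∷ unitV j

  dot-unitV : ∀ {n} (j : Fin n) w → dot (unitV j) w ≡ lookup w j
  dot-unitV {suc n} Fin.zero (x ∷ w) =
    trans (cong (1ℚ * x +_) (dot-allZero (Vec.replicate n 0ℚ) w λ j → Vecₚ.lookup-replicate j 0ℚ))
          (solve 1 (λ x → con 1ℚ :* x :+ con 0ℚ := x) refl x)
  dot-unitV (Fin.suc j) (x ∷ w) = trans (cong (0ℚ * x +_) (dot-unitV j w))
    (solve 2 (λ x y → con 0ℚ :* x :+ y := y) refl x (lookup w j))

  termForm : ∀ {n} → Term n → Vec ℚ n
  termForm (var j)  = unitV j
  termForm (s +ₜ t) = addV (termForm s) (termForm t)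

  coeff-evalT : ∀ {n} (t : Term n) ρ i → coeff (evalT t ρ) i ≡ dot (termForm t) (column ρ i)
  coeff-evalT (var j)  ρ i =
    sym (trans (dot-unitV j (column ρ i)) (Vecₚ.lookup-map j (λ v → coeff v i) ρ))
  coeff-evalT (s +ₜ t) ρ i = begin
    coeff (evalT s ρ ⊕ evalT t ρ) i           ≡⟨ coeff-⊕ (evalT s ρ) (evalT t ρ) i ⟩
    coeff (evalT s ρ) i + coeff (evalT t ρ) i ≡⟨ cong₂ _+_ (coeff-evalT s ρ i) (coeff-evalT t ρ i) ⟩
    dot (termForm s) w + dot (termForm t) w   ≡⟨ sym (dot-addV (termForm s) (termForm t) w) ⟩
    dot (addV (termForm s) (termForm t)) w    ∎
    where
    open ≡-Reasoning
    w = column ρ i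

  record Vanishes {n} (l : Vec ℚ n) (ρ : Vec M n) : Set where
    constructor vanishing
    field at : ∀ i → dot l (column ρ i) ≡ 0ℚ
  open Vanishes

  vanishes? : ∀ {n} (l : Vec ℚ n) ρ → Dec (Vanishes l ρ)
  vanishes? l ρ = map′ (λ l·ρ≈0 → vanishing λ i → trans (sym (coeff-lincomb l ρ i)) (l·ρ≈0 i))
                       (λ l·ρ≡0 i → trans (coeff-lincomb l ρ i) (at l·ρ≡0 i))
                       (lincomb l ρ ≈? 𝟎)

  SamePattern : ∀ {n} → List (Vec ℚ n) → Vec M n → Vec M n → Set
  SamePattern A ρ ρ' = ∀ {l} → l ∈ A → Vanishes l ρ ⇔ Vanishes l ρ'

  samePattern-sym : ∀ {n} {A : List (Vec ℚ n)} {ρ ρ'} → SamePattern A ρ ρ' → SamePattern A ρ' ρ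
  samePattern-sym same l∈A = ⇔-sym (same l∈A)

  samePattern-++ˡ : ∀ {n} {A B : List (Vec ℚ n)} {ρ ρ'} →
                    SamePattern (A List.++ B) ρ ρ' → SamePattern A ρ ρ'
  samePattern-++ˡ same l∈A = same (∈-++⁺ˡ l∈A)

  samePattern-++ʳ : ∀ {n} {A B : List (Vec ℚ n)} {ρ ρ'} →
                    SamePattern (A List.++ B) ρ ρ' → SamePattern B ρ ρ'
  samePattern-++ʳ {A = A} same l∈B = same (∈-++⁺ʳ A l∈B)

  PatternDetermined : ∀ {n} → Formula n → Set
  PatternDetermined {n} φ =
    ∃ λ (A : List (Vec ℚ n)) → ∀ ρ ρ' → SamePattern A ρ ρ' → Sat φ ρ → Sat φ ρ'

  atomForm : ∀ {n} → Term n → Term n → Vec ℚ n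
  atomForm s t = addV (termForm s) (negV (termForm t))

  sat-≐⇔vanishes : ∀ {n} (s t : Term n) ρ → Sat (s ≐ t) ρ ⇔ Vanishes (atomForm s t) ρ
  sat-≐⇔vanishes s t ρ = mk⇔
    (λ s≈t → vanishing λ i →
       trans (dot-atomForm i)
             (x≈y⇒x∙y⁻¹≈ε (trans (sym (coeff-evalT s ρ i)) (trans (s≈t i) (coeff-evalT t ρ i)))))
    (λ s-t≡0 i →
       trans (coeff-evalT s ρ i) (trans (x∙y⁻¹≈ε⇒x≈y _ _ (trans (sym (dot-atomForm i)) (at s-t≡0 i)))
                                        (sym (coeff-evalT t ρ i))))
    where
    dot-atomForm : ∀ i → dot (atomForm s t) (column ρ i)
                       ≡ dot (termForm s) (column ρ i) + - dot (termForm t) (column ρ i)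
    dot-atomForm i = trans (dot-addV (termForm s) _ (column ρ i))
                           (cong (dot (termForm s) (column ρ i) +_) (dot-negV (termForm t) (column ρ i)))

  eliminate : ∀ {n} → Vec ℚ (suc n) → Vec ℚ (suc n) → Vec ℚ n
  eliminate (c ∷ l) (c' ∷ l') = addV (scaleV c l') (scaleV (- c') l)

  dot-eliminate : ∀ {n} c (l : Vec ℚ n) c' l' x w →
                  c * dot (c' ∷ l') (x ∷ w) ≡ c' * dot (c ∷ l) (x ∷ w) + dot (eliminate (c ∷ l) (c' ∷ l')) w
  dot-eliminate c l c' l' x w = begin
    c * (c' * x + L')                                      ≡⟨ solve 5 (λ c c' x L L' →
                                                                c :* (c' :* x :+ L') := c' :* (c :* x :+ L) :+ (c :* L' :+ :- c' :* L))
                                                              refl c c' x L L' ⟩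
    c' * (c * x + L) + (c * L' + - c' * L)                 ≡⟨ cong (c' * (c * x + L) +_) (sym dot-combination) ⟩
    c' * (c * x + L) + dot (eliminate (c ∷ l) (c' ∷ l')) w ∎
    where
    open ≡-Reasoning
    L = dot l w
    L' = dot l' w
    dot-combination : dot (addV (scaleV c l') (scaleV (- c') l)) w ≡ c * L' + - c' * L
    dot-combination =
      trans (dot-addV (scaleV c l') _ w) (cong₂ _+_ (dot-scaleV c l' w) (dot-scaleV (- c') l w))

  vanishes-eliminate : ∀ {n c} {l : Vec ℚ n} {x ρ} → c ≢ 0ℚ → Vanishes (c ∷ l) (x ∷ ρ) →
                       ∀ l' → Vanishes l' (x ∷ ρ) ⇔ Vanishes (eliminate (c ∷ l) l') ρ
  vanishes-eliminate {c = c} {l} {x} {ρ} c≢0 root (c' ∷ l') = mk⇔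
    (λ vanishes → vanishing λ i → trans (sym (c·v≡e i)) (Equivalence.to (≡0⇔*≡0 c≢0 _) (at vanishes i)))
    (λ vanishes → vanishing λ i → Equivalence.from (≡0⇔*≡0 c≢0 _) (trans (c·v≡e i) (at vanishes i)))
    where
    e : ℕ → ℚ
    e i = dot (eliminate (c ∷ l) (c' ∷ l')) (column ρ i)
    c·v≡e : ∀ i → c * dot (c' ∷ l') (column (x ∷ ρ) i) ≡ e i
    c·v≡e i = begin
      c * dot (c' ∷ l') (column (x ∷ ρ) i)        ≡⟨ dot-eliminate c l c' l' (coeff x i) (column ρ i) ⟩
      c' * dot (c ∷ l) (column (x ∷ ρ) i) + e i   ≡⟨ cong (λ v → c' * v + e i) (at root i) ⟩
      c' * 0ℚ + e i                               ≡⟨ solve 2 (λ c' e → c' :* con 0ℚ :+ e := e) refl c' (e i) ⟩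
      e i                                         ∎
      where open ≡-Reasoning

  vanishes-zero-head : ∀ {n} (l : Vec ℚ n) x ρ → Vanishes (0ℚ ∷ l) (x ∷ ρ) ⇔ Vanishes l ρ
  vanishes-zero-head l x ρ = mk⇔ (λ vanishes → vanishing λ i → trans (sym (0x+v≡v i)) (at vanishes i))
                                 (λ vanishes → vanishing λ i → trans (0x+v≡v i) (at vanishes i))
    where
    0x+v≡v : ∀ i → 0ℚ * coeff x i + dot l (column ρ i) ≡ dot l (column ρ i)
    0x+v≡v i = solve 2 (λ x v → con 0ℚ :* x :+ v := v) refl (coeff x i) (dot l (column ρ i))

  eliminationForms : ∀ {n} → List (Vec ℚ (suc n)) → List (Vec ℚ n)
  eliminationForms A = List.map Vec.tail A List.++ List.cartesianProductWith eliminate A A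

  module _ {n} (A : List (Vec ℚ (suc n))) {ρ ρ' : Vec M n}
           (same : SamePattern (eliminationForms A) ρ ρ') where

    transport-root : ∀ {c l x} → (c ∷ l) ∈ A → (c≢0 : c ≢ 0ℚ) → Vanishes (c ∷ l) (x ∷ ρ) →
                     SamePattern A (x ∷ ρ) (lincomb (scaleV (rootScale c≢0) l) ρ' ∷ ρ')
    transport-root {c} {l} {x} cl∈A c≢0 root {l'} l'∈A =
      ⇔-sym (vanishes-eliminate c≢0 root' l')
        ⇔-∘ (same (∈-++⁺ʳ (List.map Vec.tail A) (∈-cartesianProductWith⁺ eliminate cl∈A l'∈A))
        ⇔-∘ vanishes-eliminate c≢0 root l')
      where
      k = rootScale c≢0
      x' = lincomb (scaleV k l) ρ'
      root' : Vanishes (c ∷ l) (x' ∷ ρ')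
      root' = vanishing λ i → begin
        c * coeff x' i + dot l (column ρ' i)                ≡⟨ cong (λ y → c * y + dot l (column ρ' i)) (coeff-x' i) ⟩
        c * (k * dot l (column ρ' i)) + dot l (column ρ' i) ≡⟨ rootScale-solves c≢0 _ ⟩
        0ℚ                                                  ∎
        where
        open ≡-Reasoning
        coeff-x' : ∀ i → coeff x' i ≡ k * dot l (column ρ' i)
        coeff-x' i = trans (coeff-lincomb (scaleV k l) ρ' i) (dot-scaleV k l (column ρ' i))

    transport-fresh : ∀ {x} → ¬ Any (λ l → Vec.head l ≢ 0ℚ × Vanishes l (x ∷ ρ)) A →
                      SamePattern A (x ∷ ρ) (unit (bound ρ') ∷ ρ')
    transport-fresh {x} noRoot {c ∷ l} cl∈A with c ≟ 0ℚ
    ... | yes refl = ⇔-sym (vanishes-zero-head l _ ρ')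
                       ⇔-∘ (same (∈-++⁺ˡ (∈-map⁺ Vec.tail cl∈A))
                       ⇔-∘ vanishes-zero-head l x ρ)
    ... | no  c≢0  = mk⇔ (λ root → ⊥-elim (noRoot (lose cl∈A (c≢0 , root))))
                         (λ root → ⊥-elim (c≢0 (trans (sym value-at-N) (at root N))))
      where
      N = bound ρ'
      value-at-N : c * coeff (unit N) N + dot l (column ρ' N) ≡ c
      value-at-N = begin
        c * coeff (unit N) N + dot l (column ρ' N) ≡⟨ cong₂ (λ u v → c * u + v) (coeff-unit-≡ N)
                                                       (trans (cong (dot l) (column-bound ρ' N ℕₚ.≤-refl)) (dot-zeroʳ l)) ⟩
        c * 1ℚ + 0ℚ                                ≡⟨ solve 1 (λ c → c :* con 1ℚ :+ con 0ℚ := c) refl c ⟩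
        c                                          ∎
        where open ≡-Reasoning

    transport : ∀ x → ∃ λ x' → SamePattern A (x ∷ ρ) (x' ∷ ρ')
    transport x with Any.any? (λ l → ¬? (Vec.head l ≟ 0ℚ) ×-dec vanishes? l (x ∷ ρ)) A
    ... | yes someRoot with find someRoot
    ...   | (c ∷ l) , cl∈A , c≢0 , root = _ , transport-root cl∈A c≢0 root
    transport x | no noRoot = _ , transport-fresh noRoot

  patternDetermined : ∀ {n} (φ : Formula n) → PatternDetermined φ
  patternDetermined (s ≐ t) = atomForm s t ∷ [] , λ ρ ρ' same sat →
    Equivalence.from (sat-≐⇔vanishes s t ρ')
      (Equivalence.to (same (here refl)) (Equivalence.to (sat-≐⇔vanishes s t ρ) sat))
  patternDetermined (¬' φ) with patternDetermined φ
  ... | A , tr = A , λ ρ ρ' same ¬sat sat' → ¬sat (tr ρ' ρ (samePattern-sym same) sat')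
  patternDetermined (φ ∧' ψ) with patternDetermined φ | patternDetermined ψ
  ... | A , tr | B , tr' = A List.++ B , λ ρ ρ' same (sat , sat') →
    tr ρ ρ' (samePattern-++ˡ same) sat , tr' ρ ρ' (samePattern-++ʳ {A = A} same) sat'
  patternDetermined (φ ∨' ψ) with patternDetermined φ | patternDetermined ψ
  ... | A , tr | B , tr' = A List.++ B , λ
    { ρ ρ' same (inj₁ sat) → inj₁ (tr ρ ρ' (samePattern-++ˡ same) sat)
    ; ρ ρ' same (inj₂ sat) → inj₂ (tr' ρ ρ' (samePattern-++ʳ {A = A} same) sat) }
  patternDetermined (φ ⇒' ψ) with patternDetermined φ | patternDetermined ψ
  ... | A , tr | B , tr' = A List.++ B , λ ρ ρ' same imp sat →
    tr' ρ ρ' (samePattern-++ʳ {A = A} same) (imp (tr ρ' ρ (samePattern-sym (samePattern-++ˡ same)) sat))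
  patternDetermined (∃' φ) with patternDetermined φ
  ... | A , tr = eliminationForms A , λ ρ ρ' same (x , sat) →
    let x' , same' = transport A same x in x' , tr (x ∷ ρ) (x' ∷ ρ') same' sat
  patternDetermined (∀' φ) with patternDetermined φ
  ... | A , tr = eliminationForms A , λ ρ ρ' same sat x' →
    let x , same' = transport A (samePattern-sym same) x' in tr (x ∷ ρ) (x' ∷ ρ') (samePattern-sym same') (sat x)

  data Fresh (N : ℕ) : ∀ {k} → Vec M k → Set where
    []  : Fresh N []
    _∷_ : ∀ {p k} {ys : Vec M k} → N ≤ p → Fresh (suc p) ys → Fresh N (unit p ∷ ys)

  fresh-weaken : ∀ {N N' k} {ys : Vec M k} → N' ≤ N → Fresh N ys → Fresh N' ys
  fresh-weaken N'≤N []              = []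
  fresh-weaken N'≤N (N≤p ∷ fresh) = ℕₚ.≤-trans N'≤N N≤p ∷ fresh

  freshUnits : ℕ → ∀ k → Vec M k
  freshUnits N zero    = []
  freshUnits N (suc k) = unit N ∷ freshUnits (suc N) k

  fresh-freshUnits : ∀ N k → Fresh N (freshUnits N k)
  fresh-freshUnits N zero    = []
  fresh-freshUnits N (suc k) = ℕₚ.≤-refl ∷ fresh-freshUnits (suc N) k

  fresh-below : ∀ {N k} {ys : Vec M k} → Fresh N ys → ∀ d i → i < N → dot d (column ys i) ≡ 0ℚ
  fresh-below []                       []      i i<N = refl
  fresh-below (_∷_ {p} N≤p fresh) (c ∷ d) i i<N = begin
    c * coeff (unit p) i + dot d (column _ i) ≡⟨ cong₂ (λ u v → c * u + v)
                                                   (coeff-unit-≢ λ p≡i → ℕₚ.<⇒≢ i<p (sym p≡i))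
                                                   (fresh-below fresh d i (ℕₚ.m<n⇒m<1+n i<p)) ⟩
    c * 0ℚ + 0ℚ                                ≡⟨ solve 1 (λ c → c :* con 0ℚ :+ con 0ℚ := con 0ℚ) refl c ⟩
    0ℚ                                         ∎
    where
    open ≡-Reasoning
    i<p = ℕₚ.<-≤-trans i<N N≤p

  -- Each coefficient is read off at the position of its unit vector.
  fresh-allZero : ∀ {N k} {ys : Vec M k} → Fresh N ys → ∀ d →
                  (∀ i → N ≤ i → dot d (column ys i) ≡ 0ℚ) → AllZero d
  fresh-allZero []                      []      _         ()
  fresh-allZero (_∷_ {p} {ys = ys} N≤p fresh) (c ∷ d) vanishes = λ
    { Fin.zero    → c≡0
    ; (Fin.suc j) → fresh-allZero fresh d d-vanishes j }
    where
    open ≡-Reasoning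
    c≡0 : c ≡ 0ℚ
    c≡0 = begin
      c                                          ≡⟨ solve 1 (λ c → c := c :* con 1ℚ :+ con 0ℚ) refl c ⟩
      c * 1ℚ + 0ℚ                                ≡⟨ sym (cong₂ (λ u v → c * u + v) (coeff-unit-≡ p)
                                                                                   (fresh-below fresh d p ℕₚ.≤-refl)) ⟩
      c * coeff (unit p) p + dot d (column ys p) ≡⟨ vanishes p N≤p ⟩
      0ℚ                                         ∎
    d-vanishes : ∀ i → suc p ≤ i → dot d (column ys i) ≡ 0ℚ
    d-vanishes i p<i = begin
      dot d (column ys i)                         ≡⟨ solve 2 (λ u v → v := con 0ℚ :* u :+ v) refl (coeff (unit p) i) _ ⟩
      0ℚ * coeff (unit p) i + dot d (column ys i) ≡⟨ cong (λ u → u * coeff (unit p) i + dot d (column ys i)) (sym c≡0) ⟩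
      c * coeff (unit p) i + dot d (column ys i)  ≡⟨ vanishes i (ℕₚ.≤-trans N≤p (ℕₚ.<⇒≤ p<i)) ⟩
      0ℚ                                          ∎

  fresh⇒linIndep : ∀ {N k} {ys : Vec M k} → Fresh N ys → LinIndep ys
  fresh⇒linIndep {ys = ys} fresh d d·ys≈0 =
    fresh-allZero fresh d λ i _ → trans (sym (coeff-lincomb d ys i)) (d·ys≈0 i)

  fresh⇒trivialIntersection : ∀ {N n k} (a : Vec M n) {ys : Vec M k} → bound a ≤ N → Fresh N ys →
                              TrivialIntersection a ys
  fresh⇒trivialIntersection a {ys} bound≤N fresh c d c·a≈d·ys i = trans (c·a≈d·ys i) (begin
    coeff (lincomb d ys) i ≡⟨ coeff-lincomb d ys i ⟩
    dot d (column ys i)    ≡⟨ dot-allZero d (column ys i) d≡0 ⟩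
    0ℚ                     ∎)
    where
    open ≡-Reasoning
    c·a-beyond-bound : ∀ i → bound a ≤ i → coeff (lincomb c a) i ≡ 0ℚ
    c·a-beyond-bound i bound≤i =
      trans (coeff-lincomb c a i) (trans (cong (dot c) (column-bound a i bound≤i)) (dot-zeroʳ c))
    d≡0 : AllZero d
    d≡0 = fresh-allZero fresh d λ i N≤i → trans (sym (coeff-lincomb d ys i))
            (trans (sym (c·a≈d·ys i)) (c·a-beyond-bound i (ℕₚ.≤-trans bound≤N N≤i)))

  Constraint : ℕ → Set
  Constraint m = M × Vec ℚ m

  Satisfies : ∀ {m} → Constraint m → Vec M m → Set
  Satisfies (s , l) y = ∀ i → coeff s i + dot l (column y i) ≡ 0ℚ

  Avoids : ∀ {m} → List (Constraint m) → Vec M m → Set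
  Avoids C y = ∀ {s l} → (s , l) ∈ C → ¬ AllZero l → ¬ Satisfies (s , l) y

  coeff-⊕⊙ : ∀ s c y i → coeff (s ⊕ c ⊙ y) i ≡ coeff s i + c * coeff y i
  coeff-⊕⊙ s c y i = trans (coeff-⊕ s (c ⊙ y) i) (cong (coeff s i +_) (coeff-⊙ c y i))

  substitute : ∀ {m} → M → Constraint (suc m) → Constraint m
  substitute y (s , c ∷ l) = s ⊕ c ⊙ y , l

  satisfies-substitute : ∀ {m} y (κ : Constraint (suc m)) ys →
                         Satisfies κ (y ∷ ys) → Satisfies (substitute y κ) ys
  satisfies-substitute y (s , c ∷ l) ys satisfies i = begin
    coeff (s ⊕ c ⊙ y) i + dot l (column ys i)         ≡⟨ cong (_+ dot l (column ys i)) (coeff-⊕⊙ s c y i) ⟩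
    coeff s i + c * coeff y i + dot l (column ys i)   ≡⟨ ℚₚ.+-assoc (coeff s i) _ _ ⟩
    coeff s i + (c * coeff y i + dot l (column ys i)) ≡⟨ satisfies i ⟩
    0ℚ                                                 ∎
    where open ≡-Reasoning

  -- The values the first unknown must avoid: those forced by a constraint on it alone.
  Pins : ∀ {m} → Constraint (suc m) → M → Set
  Pins (s , c ∷ l) y = c ≢ 0ℚ × AllZero l × s ⊕ c ⊙ y ≈ 𝟎

  pins? : ∀ {m} (κ : Constraint (suc m)) y → Dec (Pins κ y)
  pins? (s , c ∷ l) y = ¬? (c ≟ 0ℚ) ×-dec allZero? l ×-dec s ⊕ c ⊙ y ≈? 𝟎

  pins-unique : ∀ {m} (κ : Constraint (suc m)) {y y'} → Pins κ y → Pins κ y' → y ≈ y'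
  pins-unique (s , c ∷ l) {y} {y'} (c≢0 , _ , s⊕cy≈0) (_ , _ , s⊕cy'≈0) i =
    *-cancelˡ-≡ c≢0 _ _ (trans (cy≡-s y s⊕cy≈0) (sym (cy≡-s y' s⊕cy'≈0)))
    where
    cy≡-s : ∀ y → s ⊕ c ⊙ y ≈ 𝟎 → c * coeff y i ≡ - coeff s i
    cy≡-s y s⊕cy≈0 = inverseʳ-unique (coeff s i) _ (trans (sym (coeff-⊕⊙ s c y i)) (s⊕cy≈0 i))

  avoids-∷ : ∀ {m} {C : List (Constraint (suc m))} {y ys} → ¬ Any (λ κ → Pins κ y) C →
             Avoids (List.map (substitute y) C) ys → Avoids C (y ∷ ys)
  avoids-∷ {y = y} {ys} unpinned avoids {s} {c ∷ l} κ∈C notZero satisfies with allZero? l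
  ... | no  l≢0 = avoids (∈-map⁺ (substitute y) κ∈C) l≢0 (satisfies-substitute y (s , c ∷ l) ys satisfies)
  ... | yes l≡0 = unpinned (lose κ∈C (c≢0 , l≡0 , s⊕cy≈0))
    where
    c≢0 : c ≢ 0ℚ
    c≢0 c≡0 = notZero λ { Fin.zero → c≡0 ; (Fin.suc j) → l≡0 j }
    s⊕cy≈0 : s ⊕ c ⊙ y ≈ 𝟎
    s⊕cy≈0 i = begin
      coeff (s ⊕ c ⊙ y) i                       ≡⟨ sym (ℚₚ.+-identityʳ _) ⟩
      coeff (s ⊕ c ⊙ y) i + 0ℚ                  ≡⟨ cong (coeff (s ⊕ c ⊙ y) i +_) (sym (dot-allZero l (column ys i) l≡0)) ⟩
      coeff (s ⊕ c ⊙ y) i + dot l (column ys i) ≡⟨ satisfies-substitute y (s , c ∷ l) ys satisfies i ⟩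
      0ℚ                                        ∎
      where open ≡-Reasoning

  module _ (K : ℕ) where

    exists-avoiding : ∀ {m} (C : List (Constraint m)) {Q : Vec M m → Set} → length C ≤ K →
                      ExistsMoreThanTuple K m Q → ∃ λ y → Q y × Avoids C y
    exists-avoiding {zero}  C |C|≤K q = [] , q , λ _ notZero _ → notZero λ ()
    exists-avoiding {suc m} C |C|≤K (f , distinct , many) =
      let i , unpinned = pigeonhole-avoid _≈_ Pins pins? pins-unique f distinct C |C|≤K
          ys , q , avoids = exists-avoiding (List.map (substitute (f i)) C)
                              (subst (_≤ K) (sym (Listₚ.length-map (substitute (f i)) C)) |C|≤K) (many i)
      in f i ∷ ys , q , avoids-∷ unpinned avoids

    exists-fresh : ∀ m N {Q : Vec M m → Set} → (∀ ys → Fresh N ys → Q ys) → ExistsMoreThanTuple K m Q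
    exists-fresh zero    N q = q [] []
    exists-fresh (suc m) N q = candidate , distinct , λ i →
      exists-fresh m (N ℕ.+ suc K) λ ys fresh →
        q (candidate i ∷ ys) (ℕₚ.m≤m+n N (toℕ i) ∷ fresh-weaken (ℕₚ.+-monoʳ-< N (Finₚ.toℕ<n i)) fresh)
      where
      candidate : Fin (suc K) → M
      candidate i = unit (N ℕ.+ toℕ i)
      distinct : ∀ i j → i ≢ j → ¬ candidate i ≈ candidate j
      distinct i j i≢j same = i≢j (Finₚ.toℕ-injective (ℕₚ.+-cancelˡ-≡ N _ _ (unit-injective _ _ same)))

  module Split {n m : ℕ} where

    leftPart : Vec ℚ (n ℕ.+ m) → Vec ℚ n
    leftPart l = proj₁ (Vec.splitAt n l)

    rightPart : Vec ℚ (n ℕ.+ m) → Vec ℚ m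
    rightPart l = proj₁ (proj₂ (Vec.splitAt n l))

    dot-split : ∀ l (a : Vec M n) (y : Vec M m) i →
                dot l (column (a ++ y) i) ≡ dot (leftPart l) (column a i) + dot (rightPart l) (column y i)
    dot-split l a y i = trans (cong₂ dot (proj₂ (proj₂ (Vec.splitAt n l))) (Vecₚ.map-++ (λ v → coeff v i) a y))
                              (dot-++ (leftPart l) (rightPart l) (column a i) (column y i))

    dot-rightPart-zero : ∀ l (a : Vec M n) y y' i → AllZero (rightPart l) →
                         dot l (column (a ++ y) i) ≡ dot l (column (a ++ y') i)
    dot-rightPart-zero l a y y' i r≡0 = begin
      dot l (column (a ++ y) i)                                       ≡⟨ dot-split l a y i ⟩
      dot (leftPart l) (column a i) + dot (rightPart l) (column y i)  ≡⟨ cong (dot (leftPart l) (column a i) +_)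
                                                                           (trans (dot-allZero (rightPart l) _ r≡0)
                                                                                  (sym (dot-allZero (rightPart l) _ r≡0))) ⟩
      dot (leftPart l) (column a i) + dot (rightPart l) (column y' i) ≡⟨ sym (dot-split l a y' i) ⟩
      dot l (column (a ++ y') i)                                      ∎
      where open ≡-Reasoning

  module Genericity {n m} (A : List (Vec ℚ (n ℕ.+ m))) (a : Vec M n) where
    open Split {n} {m}

    record Generic (y : Vec M m) : Set where
      constructor generic
      field omits-y : ∀ {l} → l ∈ A → Vanishes l (a ++ y) → AllZero (rightPart l)
    open Generic

    generic-samePattern : ∀ {y y'} → Generic y → Generic y' → SamePattern A (a ++ y) (a ++ y')
    generic-samePattern {y} {y'} gen gen' {l} l∈A = mk⇔
      (λ vanishes → vanishing λ i → trans (dot-rightPart-zero l a y' y i (omits-y gen l∈A vanishes)) (at vanishes i))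
      (λ vanishes → vanishing λ i → trans (dot-rightPart-zero l a y y' i (omits-y gen' l∈A vanishes)) (at vanishes i))

    independent⇒generic : ∀ {b} → LinIndep b → TrivialIntersection a b → Generic b
    independent⇒generic {b} independent trivial = generic omits
      where
      omits : ∀ {l} → l ∈ A → Vanishes l (a ++ b) → AllZero (rightPart l)
      omits {l} l∈A vanishes = independent (rightPart l) λ i → begin
        coeff (lincomb (rightPart l) b) i       ≡⟨ sym (negated i) ⟩
        coeff (lincomb (negV (leftPart l)) a) i ≡⟨ trivial (negV (leftPart l)) (rightPart l) negated i ⟩
        0ℚ                                      ∎
        where
        open ≡-Reasoning
        negated : lincomb (negV (leftPart l)) a ≈ lincomb (rightPart l) b
        negated i = begin
          coeff (lincomb (negV (leftPart l)) a) i ≡⟨ coeff-lincomb (negV (leftPart l)) a i ⟩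
          dot (negV (leftPart l)) (column a i)    ≡⟨ dot-negV (leftPart l) (column a i) ⟩
          - dot (leftPart l) (column a i)         ≡⟨ sym (inverseʳ-unique _ _ (trans (sym (dot-split l a b i)) (at vanishes i))) ⟩
          dot (rightPart l) (column b i)          ≡⟨ sym (coeff-lincomb (rightPart l) b i) ⟩
          coeff (lincomb (rightPart l) b) i       ∎

    constraints : List (Constraint m)
    constraints = List.map (λ l → lincomb (leftPart l) a , rightPart l) A

    avoids⇒generic : ∀ {y} → Avoids constraints y → Generic y
    avoids⇒generic {y} avoids = generic omits
      where
      omits : ∀ {l} → l ∈ A → Vanishes l (a ++ y) → AllZero (rightPart l)
      omits {l} l∈A vanishes with allZero? (rightPart l)
      ... | yes r≡0 = r≡0
      ... | no  r≢0 = ⊥-elim (avoids (∈-map⁺ (λ l → lincomb (leftPart l) a , rightPart l) l∈A) r≢0 λ i →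
            trans (cong (_+ _) (coeff-lincomb (leftPart l) a i)) (trans (sym (dot-split l a y i)) (at vanishes i)))

    exists-generic : ∀ {Q} → ExistsMoreThanTuple (length A) m Q → ∃ λ y → Q y × Generic y
    exists-generic many with exists-avoiding (length A) constraints (ℕₚ.≤-reflexive (Listₚ.length-map _ A)) many
    ... | y , q , avoids = y , q , avoids⇒generic avoids

    avoiding : Vec M m
    avoiding = freshUnits (bound a) m

    avoiding-linIndep : LinIndep avoiding
    avoiding-linIndep = fresh⇒linIndep (fresh-freshUnits (bound a) m)

    avoiding-trivialIntersection : TrivialIntersection a avoiding
    avoiding-trivialIntersection = fresh⇒trivialIntersection a ℕₚ.≤-refl (fresh-freshUnits (bound a) m)

    avoiding-generic : Generic avoiding
    avoiding-generic = independent⇒generic avoiding-linIndep avoiding-trivialIntersection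

    many-generic : ∀ K {Q} → (∀ y → Generic y → Q y) → ExistsMoreThanTuple K m Q
    many-generic K q = exists-fresh K m (bound a) λ ys fresh →
      q ys (independent⇒generic (fresh⇒linIndep fresh) (fresh⇒trivialIntersection a ℕₚ.≤-refl fresh))

open import Data.Nat.Base using (_+_)

corollary1 : (n m : ℕ) (φ : Formula (n + m)) →
    Σ ℕ λ K → (a : Vec M n) →
      ((Σ (Vec M m) λ b → LinIndep b × TrivialIntersection a b × Rel φ a b)
        ⇔ ExistsMoreThanTuple K m (Rel φ a))
      × (((b : Vec M m) → LinIndep b → TrivialIntersection a b → Rel φ a b)
        ⇔ ExistsMoreThanTuple K m (Rel φ a))
corollary1 n m φ = length A , λ a →
    mk⇔ (λ (b , independent , trivial , r) → many-generic a (length A) λ y gen →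
           transfer (independent⇒generic a independent trivial) gen r)
        (λ many → let y , r , gen = exists-generic a many in
           avoiding a , avoiding-linIndep a , avoiding-trivialIntersection a , transfer gen (avoiding-generic a) r)
  , mk⇔ (λ all → many-generic a (length A) λ y gen →
           transfer (avoiding-generic a) gen (all _ (avoiding-linIndep a) (avoiding-trivialIntersection a)))
        (λ many b independent trivial → let y , r , gen = exists-generic a many in
           transfer gen (independent⇒generic a independent trivial) r)
  where
  A = proj₁ (patternDetermined φ)
  open Genericity {n} {m} A
  transfer : ∀ {a : Vec M n} {y y' : Vec M m} → Generic a y → Generic a y' → Rel φ a y → Rel φ a y'
  transfer {a} {y} {y'} gen gen' = proj₂ (patternDetermined φ) (a ++ y) (a ++ y') (generic-samePattern a gen gen')
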